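{- Let $n\ge1$, $\mathbb{Z}_n=\{0,\dots,n-1\}$, let $\mathbf{X}$ be the $n\times n$ matrix with $\mathbf{X}[i,j]=x^{n^{|i-j|}}$, and define \[ P_{\mathbf{X}}(x)=\sum_{\substack{f:\mathbb{Z}_n\to\mathbb{Z}_n\\ |f^{(n-1)}(\mathbb{Z}_n)|=1}}\ \prod_{i\in\mathbb{Z}_n}\mathbf{X}[i,f(i)]. \] For a non-decreasing sequence $s=(s_0,\dots,s_{n-1})$ with entries in $\mathbb{Z}_n$ put $e(s)=\sum_{k=0}^{n-1}n^{s_k}$. Then distinct sequences $s$ that occur as induced subtractive edge label sequences of functional trees on $\mathbb{Z}_n$ give distinct exponents $e(s)$, and for every such $s$ the coefficient of $x^{e(s)}$ in $P_{\mathbf{X}}(x)$ equals the number of functional trees $G_f$ on $\mathbb{Z}_n$ with induced subtractive edge label sequence $s$. That is, $P_{\mathbf{X}}$ is the generating function whose coefficients enumerate the functional trees on $n$ vertices having the same induced subtractive edge label sequence.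
   Context: For $f:\mathbb{Z}_n\to\mathbb{Z}_n$, $f^{(0)}$ is the identity and $f^{(k+1)}=f\circ f^{(k)}$. The functional directed graph $G_f$ has vertex set $\mathbb{Z}_n$ and edges $(i,f(i))$; it is a functional tree if $|f^{(n-1)}(\mathbb{Z}_n)|=1$. The induced subtractive edge label of edge $(i,f(i))$ is $|f(i)-i|$, and the induced subtractive edge label sequence of $G_f$ is the non-decreasing rearrangement of $(|f(i)-i|)_{i\in\mathbb{Z}_n}$. -}

module Defs where

open import Data.Nat using (ℕ; zero; suc; _+_; _*_; _^_; _≤_; ∣_-_∣; _≟_)
open import Data.Nat.Properties using (≤-decTotalOrder)
open import Data.Fin using (Fin; toℕ)
import Data.Fin as F
open import Data.Fin.Properties using () renaming (_≟_ to _≟F_)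
open import Data.List using (List; []; _∷_; map; length; filter; deduplicate; allFin; foldr; concatMap; upTo)
import Data.List.Properties as LP
open import Data.Vec as V using (Vec)
open import Data.Product using (Σ; _×_; _,_)
open import Data.Bool using (if_then_else_)
open import Relation.Nullary using (Dec; does)
open import Relation.Nullary.Decidable using (_×-dec_)
open import Relation.Binary.PropositionalEquality using (_≡_)
open import Function using (_∘_; id)
open import Data.List.Sort.InsertionSort ≤-decTotalOrder using (sort)

Fun : ℕ → Set
Fun n = Fin n → Fin n

allVecs : (m k : ℕ) → List (Vec (Fin k) m)
allVecs zero    k = V.[] ∷ []
allVecs (suc m) k = concatMap (λ i → map (i V.∷_) (allVecs m k)) (allFin k)

allFuns : (n : ℕ) → List (Fun n)
allFuns n = map V.lookup (allVecs n n)

iter : ∀ {n} → Fun n → ℕ → Fun n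
iter f zero    = id
iter f (suc k) = f ∘ iter f k

image : ∀ {n} → Fun n → List (Fin n)
image {n} g = deduplicate _≟F_ (map g (allFin n))

IsFunctionalTree : ∀ {n} → Fun n → Set
IsFunctionalTree {n} f = length (image (iter f (n Data.Nat.∸ 1))) ≡ 1

isFunctionalTree? : ∀ {n} (f : Fun n) → Dec (IsFunctionalTree f)
isFunctionalTree? {n} f = length (image (iter f (n Data.Nat.∸ 1))) ≟ 1

-- induced subtractive edge label sequence: non-decreasing rearrangement
-- of (|f(i) - i|)_{i ∈ ℤ_n}
labelSeq : ∀ {n} → Fun n → List ℕ
labelSeq {n} f = sort (map (λ i → ∣ toℕ (f i) - toℕ i ∣) (allFin n))

expo : ℕ → List ℕ → ℕ
expo n s = foldr (λ sk acc → n ^ sk + acc) 0 s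

-- Formal polynomials in x with ℕ coefficients, as coefficient sequences

Poly : Set
Poly = ℕ → ℕ

monomial : ℕ → Poly
monomial d m = if does (m ≟ d) then 1 else 0

zeroP : Poly
zeroP _ = 0

oneP : Poly
oneP = monomial 0

_+P_ : Poly → Poly → Poly
(p +P q) m = p m + q m

_*P_ : Poly → Poly → Poly
(p *P q) m = foldr (λ k acc → p k * q (m Data.Nat.∸ k) + acc) 0 (upTo (suc m))

coeff : Poly → ℕ → ℕ
coeff p m = p m

Xmat : (n : ℕ) → Fin n → Fin n → Poly
Xmat n i j = monomial (n ^ ∣ toℕ i - toℕ j ∣)

prodTerm : (n : ℕ) → Fun n → Poly
prodTerm n f = foldr (λ i acc → Xmat n i (f i) *P acc) oneP (allFin n)

PX : (n : ℕ) → Poly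
PX n = foldr (λ f acc → (if does (isFunctionalTree? f) then prodTerm n f else zeroP) +P acc)
             zeroP (allFuns n)

countTrees : (n : ℕ) → List ℕ → ℕ
countTrees n s = length (filter (λ f → isFunctionalTree? f ×-dec LP.≡-dec _≟_ (labelSeq f) s) (allFuns n))

-- Write occ v s for the number of occurrences of v in s.  The exponent
-- e(s) = Σ_k n^{s_k} is the base-n number whose digit at position v is
-- occ v s, provided every occ v s is below n.  Base-n representations are
-- unique, so two sorted sequences with all multiplicities below n and the
-- same exponent coincide (expo-unique).  A functional tree on n ≥ 2
-- vertices has exactly one fixed point (its root), so its labels contain
-- both 0 and a non-zero value and no value can fill all n positions
-- (labelSeq-occurrences-bounded); hence e is injective on the label
-- sequences of trees (tree-exponents-injective).
--
-- On the polynomial side, ∏_i X[i,f(i)] is the single monomial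
-- x^{e(labelSeq f)} (prodTerm-monomial).  The coefficient of x^{e(s)} in
-- P_X therefore counts the trees f whose exponent e(labelSeq f) equals e(s),
-- which by injectivity are exactly the trees with labelSeq f ≡ s.
module Submission where

open import Defs
open import Data.Nat
open import Data.Nat.Properties
open import Data.Nat.DivMod using (_%_; [m+kn]%n≡m%n; m<n⇒m%n≡m)
open import Data.Nat.Tactic.RingSolver using (solve-∀)
open import Data.Fin using (Fin; toℕ) renaming (zero to fzero; suc to fsuc)
open import Data.Fin.Properties using (toℕ-injective) renaming (_≟_ to _≟F_; 0≢1+n to 0F≢1+n)
open import Data.List using (List; []; _∷_; map; length; filter; allFin; foldr; upTo)
import Data.List.Properties as LP
open import Data.List.Relation.Unary.All as All using (All; []; _∷_)
open import Data.List.Relation.Unary.All.Properties using (¬Any⇒All¬; All¬⇒¬Any)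
open import Data.List.Relation.Unary.Any as Any using (here; there)
open import Data.List.Relation.Unary.AllPairs using (_∷_)
open import Data.List.Relation.Unary.Unique.Propositional using (Unique)
open import Data.List.Relation.Unary.Unique.Propositional.Properties using (upTo⁺)
open import Data.List.Relation.Unary.Linked as Linked using (Linked)
open import Data.List.Relation.Unary.Linked.Properties using (Linked⇒All)
open import Data.List.Membership.Propositional using (_∈_; _∉_)
open import Data.List.Membership.Propositional.Properties
  using (∈-deduplicate⁺; ∈-map⁺; ∈-allFin; ∈-upTo⁺; ∈-upTo⁻)
open import Data.List.Relation.Binary.Permutation.Propositional as Perm using (_↭_; prep; swap; ↭-sym)
open import Data.List.Relation.Binary.Permutation.Propositional.Properties using (↭-length; filter-↭)
open import Data.List.Sort.InsertionSort ≤-decTotalOrder using (sort)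
open import Data.List.Sort.InsertionSort.Properties ≤-decTotalOrder using (sort-↭; sort-↗)
open import Data.Product using (Σ; ∃-syntax; _×_; _,_)
open import Data.Bool using (if_then_else_)
open import Data.Empty using (⊥; ⊥-elim)
open import Relation.Nullary using (does; yes; no; ¬_)
open import Relation.Nullary.Decidable using (dec-true; dec-false; _×-dec_)
open import Relation.Unary using (Pred; Decidable)
open import Level using (0ℓ)
open import Relation.Binary.PropositionalEquality
open import Relation.Binary.Definitions using (tri<; tri≈; tri>)

occ : ℕ → List ℕ → ℕ
occ v xs = length (filter (v ≟_) xs)

occ-here : ∀ v xs → occ v (v ∷ xs) ≡ suc (occ v xs)
occ-here v xs = cong length (LP.filter-accept (v ≟_) refl)

occ-there : ∀ {v x} xs → v ≢ x → occ v (x ∷ xs) ≡ occ v xs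
occ-there {v} xs v≢x = cong length (LP.filter-reject (v ≟_) v≢x)

occ-tail : ∀ v x xs → occ v xs ≤ occ v (x ∷ xs)
occ-tail v x xs with v ≟ x
... | yes refl = ≤-trans (n≤1+n _) (≤-reflexive (sym (occ-here v xs)))
... | no v≢x   = ≤-reflexive (sym (occ-there xs v≢x))

occ-↭ : ∀ v {xs ys} → xs ↭ ys → occ v xs ≡ occ v ys
occ-↭ v xs↭ys = ↭-length (filter-↭ (v ≟_) xs↭ys)

occ-absent : ∀ {v xs} → v ∉ xs → occ v xs ≡ 0
occ-absent {v} {xs} v∉xs = cong length (LP.filter-none (v ≟_) (¬Any⇒All¬ xs v∉xs))

occ-unique : ∀ {v xs} → Unique xs → v ∈ xs → occ v xs ≡ 1
occ-unique {v} {_ ∷ xs} (v≢xs ∷ _) (here refl) =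
  trans (occ-here v xs) (cong suc (occ-absent (All¬⇒¬Any v≢xs)))
occ-unique {v} {x ∷ xs} (x≢xs ∷ xs-unique) (there v∈xs) =
  trans (occ-there xs (λ v≡x → All.lookup x≢xs v∈xs (sym v≡x))) (occ-unique xs-unique v∈xs)

occ-<-length : ∀ {v z xs} → z ∈ xs → v ≢ z → occ v xs < length xs
occ-<-length {v} {xs = xs} z∈xs v≢z =
  LP.filter-notAll (v ≟_) xs (Any.map (λ z≡w v≡w → v≢z (trans v≡w (sym z≡w))) z∈xs)

occ-<-length-two : ∀ {x y xs} → x ∈ xs → y ∈ xs → x ≢ y → ∀ v → occ v xs < length xs
occ-<-length-two {x} x∈xs y∈xs x≢y v with v ≟ x
... | yes refl = occ-<-length y∈xs x≢y
... | no v≢x   = occ-<-length x∈xs v≢x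

Sorted : List ℕ → Set
Sorted = Linked _≤_

-- every value occurs fewer than n times, so occ v s is a base-n digit
OccurrencesBelow : ℕ → List ℕ → Set
OccurrencesBelow n xs = ∀ v → occ v xs < n

expo-↭ : ∀ n {xs ys} → xs ↭ ys → expo n xs ≡ expo n ys
expo-↭ n Perm.refl          = refl
expo-↭ n (prep x xs↭ys)     = cong (n ^ x +_) (expo-↭ n xs↭ys)
expo-↭ n (swap x y xs↭ys)   = trans (sym (+-assoc (n ^ x) (n ^ y) _))
  (trans (cong₂ _+_ (+-comm (n ^ x) (n ^ y)) (expo-↭ n xs↭ys)) (+-assoc (n ^ y) (n ^ x) _))
expo-↭ n (Perm.trans p q)   = trans (expo-↭ n p) (expo-↭ n q)

expo-positive : ∀ n .{{_ : NonZero n}} x xs → 0 < expo n (x ∷ xs)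
expo-positive n x xs = <-≤-trans (m^n>0 n x) (m≤m+n (n ^ x) (expo n xs))

power-split : ∀ n {a x} → a < x → n ^ x ≡ n ^ (x ∸ suc a) * n ^ suc a
power-split n {a} {x} a<x = begin
  n ^ x                        ≡⟨ cong (n ^_) (sym (m∸n+n≡m a<x)) ⟩
  n ^ (x ∸ suc a + suc a)      ≡⟨ ^-distribˡ-+-* n (x ∸ suc a) (suc a) ⟩
  n ^ (x ∸ suc a) * n ^ suc a  ∎
  where open ≡-Reasoning

expo-decompose : ∀ n a xs → All (a ≤_) xs → ∃[ k ] expo n xs ≡ occ a xs * n ^ a + k * n ^ suc a
expo-decompose n a []       []             = 0 , refl
expo-decompose n a (x ∷ xs) (a≤x ∷ a≤xs) with expo-decompose n a xs a≤xs | a ≟ x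
... | k , eq | yes refl = k , (begin
  n ^ a + expo n xs                             ≡⟨ cong (n ^ a +_) eq ⟩
  n ^ a + (occ a xs * n ^ a + k * n ^ suc a)    ≡⟨ sym (+-assoc (n ^ a) _ _) ⟩
  suc (occ a xs) * n ^ a + k * n ^ suc a        ≡⟨ cong (λ c → c * n ^ a + k * n ^ suc a) (sym (occ-here a xs)) ⟩
  occ a (a ∷ xs) * n ^ a + k * n ^ suc a        ∎)
  where open ≡-Reasoning
... | k , eq | no a≢x = d + k , (begin
  n ^ x + expo n xs                                  ≡⟨ cong₂ _+_ (power-split n (≤∧≢⇒< a≤x a≢x)) eq ⟩
  d * n ^ suc a + (occ a xs * n ^ a + k * n ^ suc a) ≡⟨ regroup d (occ a xs) (n ^ a) k (n ^ suc a) ⟩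
  occ a xs * n ^ a + (d + k) * n ^ suc a             ≡⟨ cong (λ c → c * n ^ a + (d + k) * n ^ suc a) (sym (occ-there xs a≢x)) ⟩
  occ a (x ∷ xs) * n ^ a + (d + k) * n ^ suc a       ∎)
  where
  open ≡-Reasoning
  d = n ^ (x ∸ suc a)
  regroup : ∀ d c q k N → d * N + (c * q + k * N) ≡ c * q + (d + k) * N
  regroup = solve-∀

-- two exponents that agree also agree in the digit at a position a below
-- all entries: modulo n^(a+1) each exponent reduces to occ a · n^a
digit-agree : ∀ n .{{_ : NonZero n}} a xs ys → All (a ≤_) xs → All (a ≤_) ys →
              occ a xs < n → occ a ys < n → expo n xs ≡ expo n ys → occ a xs ≡ occ a ys
digit-agree n a xs ys a≤xs a≤ys xs<n ys<n eq = *-cancelʳ-≡ (occ a xs) (occ a ys) (n ^ a)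
  (trans (sym (lowest-digit xs a≤xs xs<n))
  (trans (cong (_% n ^ suc a) eq) (lowest-digit ys a≤ys ys<n)))
  where
  instance
    n^a≢0 : NonZero (n ^ a)
    n^a≢0 = m^n≢0 n a
    n^sa≢0 : NonZero (n ^ suc a)
    n^sa≢0 = m^n≢0 n (suc a)
  lowest-digit : ∀ zs → All (a ≤_) zs → occ a zs < n → expo n zs % n ^ suc a ≡ occ a zs * n ^ a
  lowest-digit zs a≤zs zs<n with k , split ← expo-decompose n a zs a≤zs = begin
    expo n zs % n ^ suc a                              ≡⟨ cong (_% n ^ suc a) split ⟩
    (occ a zs * n ^ a + k * n ^ suc a) % n ^ suc a     ≡⟨ [m+kn]%n≡m%n (occ a zs * n ^ a) k (n ^ suc a) ⟩
    (occ a zs * n ^ a) % n ^ suc a                     ≡⟨ m<n⇒m%n≡m (*-monoˡ-< (n ^ a) zs<n) ⟩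
    occ a zs * n ^ a                                   ∎
    where open ≡-Reasoning

-- sorted lists with different minima have different exponents: the digit at
-- the smaller minimum is positive on one side and zero on the other
smaller-head-absurd : ∀ n .{{_ : NonZero n}} {a b} s t → a < b →
  Sorted (a ∷ s) → Sorted (b ∷ t) → OccurrencesBelow n (a ∷ s) → OccurrencesBelow n (b ∷ t) →
  expo n (a ∷ s) ≢ expo n (b ∷ t)
smaller-head-absurd n {a} {b} s t a<b sorted-s sorted-t bound-s bound-t eq = digit-mismatch
  where
  a<t : All (a <_) (b ∷ t)
  a<t = Linked⇒All ≤-trans a<b sorted-t
  a∉t : a ∉ b ∷ t
  a∉t a∈t = <-irrefl refl (All.lookup a<t a∈t)
  agree : occ a (a ∷ s) ≡ occ a (b ∷ t)
  agree = digit-agree n a (a ∷ s) (b ∷ t) (Linked⇒All ≤-trans ≤-refl sorted-s)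
            (All.map <⇒≤ a<t) (bound-s a) (bound-t a) eq
  digit-mismatch : ⊥
  digit-mismatch with () ← trans (sym (occ-here a s)) (trans agree (occ-absent a∉t))

expo-unique : ∀ n .{{_ : NonZero n}} xs ys → Sorted xs → Sorted ys →
              OccurrencesBelow n xs → OccurrencesBelow n ys → expo n xs ≡ expo n ys → xs ≡ ys
expo-unique n []       []       _ _ _ _ _  = refl
expo-unique n []       (b ∷ t)  _ _ _ _ eq = ⊥-elim (<⇒≢ (expo-positive n b t) eq)
expo-unique n (a ∷ s)  []       _ _ _ _ eq = ⊥-elim (<⇒≢ (expo-positive n a s) (sym eq))
expo-unique n (a ∷ s)  (b ∷ t)  sorted-s sorted-t bound-s bound-t eq with <-cmp a b
... | tri< a<b _ _ = ⊥-elim (smaller-head-absurd n s t a<b sorted-s sorted-t bound-s bound-t eq)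
... | tri> _ _ b<a = ⊥-elim (smaller-head-absurd n t s b<a sorted-t sorted-s bound-t bound-s (sym eq))
... | tri≈ _ refl _ = cong (a ∷_) (expo-unique n s t (Linked.tail sorted-s) (Linked.tail sorted-t)
        (λ v → ≤-<-trans (occ-tail v a s) (bound-s v)) (λ v → ≤-<-trans (occ-tail v a t) (bound-t v))
        (+-cancelˡ-≡ (n ^ a) _ _ eq))

iter-comm : ∀ {n} (f : Fun n) k x → f (iter f k x) ≡ iter f k (f x)
iter-comm f zero    x = refl
iter-comm f (suc k) x = cong f (iter-comm f k x)

iter-fixed : ∀ {n} (f : Fun n) {p} → f p ≡ p → ∀ k → iter f k p ≡ p
iter-fixed f fp≡p zero    = refl
iter-fixed f fp≡p (suc k) = trans (cong f (iter-fixed f fp≡p k)) fp≡p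

length-one-∈ : ∀ {A : Set} (xs : List A) {x y} → length xs ≡ 1 → x ∈ xs → y ∈ xs → x ≡ y
length-one-∈ (_ ∷ []) _ (here x≡r) (here y≡r) = trans x≡r (sym y≡r)

tree-iter-constant : ∀ {n} (f : Fun n) → IsFunctionalTree f → ∀ i j →
                     iter f (n ∸ 1) i ≡ iter f (n ∸ 1) j
tree-iter-constant {n} f tree i j = length-one-∈ (image g) tree (in-image i) (in-image j)
  where
  g = iter f (n ∸ 1)
  in-image : ∀ i → g i ∈ image g
  in-image i = ∈-deduplicate⁺ _≟F_ (∈-map⁺ g (∈-allFin i))

label : ∀ {n} → Fun n → Fin n → ℕ
label f i = ∣ toℕ (f i) - toℕ i ∣

module FunctionalTree {n : ℕ} (f : Fun (suc n)) (tree : IsFunctionalTree f) where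

  root : Fin (suc n)
  root = iter f n fzero

  root-fixed : f root ≡ root
  root-fixed = trans (iter-comm f n fzero) (tree-iter-constant f tree (f fzero) fzero)

  fixed⇒root : ∀ {p} → f p ≡ p → p ≡ root
  fixed⇒root {p} fp≡p = trans (sym (iter-fixed f fp≡p n)) (tree-iter-constant f tree p fzero)

  label-root : label f root ≡ 0
  label-root = trans (cong (λ r → ∣ toℕ r - toℕ root ∣) root-fixed) (∣n-n∣≡0 (toℕ root))

  label-nonroot : ∀ {i} → i ≢ root → label f i ≢ 0
  label-nonroot i≢root label≡0 = i≢root (fixed⇒root (toℕ-injective (∣m-n∣≡0⇒m≡n label≡0)))

-- with at least two vertices both 0 and a non-zero label occur, so no label
-- value fills the whole sequence
labelSeq-occurrences-bounded : ∀ {n} (f : Fun (suc (suc n))) → IsFunctionalTree f →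
                               OccurrencesBelow (suc (suc n)) (labelSeq f)
labelSeq-occurrences-bounded {n} f tree v = begin-strict
  occ v (labelSeq f)  ≡⟨ occ-↭ v (sort-↭ labels) ⟩
  occ v labels        <⟨ occ-<-length-two (labelled root) (labelled other) root≢other v ⟩
  length labels       ≡⟨ trans (LP.length-map (label f) (allFin _)) (LP.length-tabulate (λ i → i)) ⟩
  suc (suc n)         ∎
  where
  open ≤-Reasoning
  open FunctionalTree f tree
  labels = map (label f) (allFin _)
  labelled : ∀ i → label f i ∈ labels
  labelled i = ∈-map⁺ (label f) (∈-allFin i)
  other : Fin (suc (suc n))
  other with root ≟F fzero
  ... | yes _ = fsuc fzero
  ... | no _  = fzero
  other≢root : other ≢ root
  other≢root with root ≟F fzero
  ... | yes root≡0 = λ 1≡root → 0F≢1+n (trans (sym root≡0) (sym 1≡root))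
  ... | no root≢0  = λ 0≡root → root≢0 (sym 0≡root)
  root≢other : label f root ≢ label f other
  root≢other eq = label-nonroot other≢root (trans (sym eq) label-root)

-- on a single vertex every function is the identity, with label sequence [0]
labelSeq-Fin1 : (f g : Fun 1) → labelSeq f ≡ labelSeq g
labelSeq-Fin1 f g = cong sort (LP.map-cong (λ i → cong (λ j → ∣ toℕ j - toℕ i ∣) (unique (f i) (g i))) (allFin 1))
  where
  unique : (i j : Fin 1) → i ≡ j
  unique fzero fzero = refl

tree-exponents-injective : (n : ℕ) → 1 ≤ n → (s t : List ℕ) →
  Σ (Fun n) (λ f → IsFunctionalTree f × labelSeq f ≡ s) →
  Σ (Fun n) (λ g → IsFunctionalTree g × labelSeq g ≡ t) →
  expo n s ≡ expo n t → s ≡ t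
tree-exponents-injective (suc zero) _ _ _ (f , _ , refl) (g , _ , refl) _ = labelSeq-Fin1 f g
tree-exponents-injective (suc (suc n)) _ _ _ (f , tree-f , refl) (g , tree-g , refl) eq =
  expo-unique (suc (suc n)) (labelSeq f) (labelSeq g)
    (sort-↗ (map (label f) (allFin _))) (sort-↗ (map (label g) (allFin _)))
    (labelSeq-occurrences-bounded f tree-f) (labelSeq-occurrences-bounded g tree-g) eq

monomial-at : ∀ {d k} → k ≡ d → monomial d k ≡ 1
monomial-at {d} {k} k≡d = cong (λ b → if b then 1 else 0) (dec-true (k ≟ d) k≡d)

monomial-off : ∀ {d k} → k ≢ d → monomial d k ≡ 0
monomial-off {d} {k} k≢d = cong (λ b → if b then 1 else 0) (dec-false (k ≟ d) k≢d)

monomial-agree : ∀ {d k d′ k′} → (k ≡ d → k′ ≡ d′) → (k′ ≡ d′ → k ≡ d) → monomial d k ≡ monomial d′ k′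
monomial-agree {d} {k} forth back with k ≟ d
... | yes k≡d = trans (monomial-at k≡d) (sym (monomial-at (forth k≡d)))
... | no k≢d  = trans (monomial-off k≢d) (sym (monomial-off (λ k′≡d′ → k≢d (back k′≡d′))))

sum-delta : ∀ (g : ℕ → ℕ) d → (∀ k → k ≢ d → g k ≡ 0) → ∀ xs →
            foldr (λ k acc → g k + acc) 0 xs ≡ occ d xs * g d
sum-delta g d vanish []       = refl
sum-delta g d vanish (x ∷ xs) with d ≟ x
... | yes refl = trans (cong (g d +_) (sum-delta g d vanish xs)) (cong (_* g d) (sym (occ-here d xs)))
... | no d≢x   = trans (cong₂ _+_ (vanish x (λ x≡d → d≢x (sym x≡d))) (sum-delta g d vanish xs))
                       (cong (_* g d) (sym (occ-there xs d≢x)))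

monomial-mul : ∀ d e (q : Poly) → (∀ k → q k ≡ monomial e k) → ∀ m → (monomial d *P q) m ≡ monomial (d + e) m
monomial-mul d e q q≡xᵉ m =
  trans (sum-delta term d (λ k k≢d → cong (_* q (m ∸ k)) (monomial-off k≢d)) (upTo (suc m))) collect
  where
  term : ℕ → ℕ
  term k = monomial d k * q (m ∸ k)
  collect : occ d (upTo (suc m)) * term d ≡ monomial (d + e) m
  collect with d ≤? m
  ... | yes d≤m = begin
    occ d (upTo (suc m)) * term d  ≡⟨ cong (_* term d) (occ-unique (upTo⁺ (suc m)) (∈-upTo⁺ (s≤s d≤m))) ⟩
    term d + 0                     ≡⟨ +-identityʳ (term d) ⟩
    monomial d d * q (m ∸ d)       ≡⟨ cong₂ _*_ (monomial-at {d} refl) (q≡xᵉ (m ∸ d)) ⟩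
    monomial e (m ∸ d) + 0         ≡⟨ +-identityʳ _ ⟩
    monomial e (m ∸ d)             ≡⟨ monomial-agree (λ m∸d≡e → trans (sym (m+[n∸m]≡n d≤m)) (cong (d +_) m∸d≡e))
                                                     (λ m≡d+e → trans (cong (_∸ d) m≡d+e) (m+n∸m≡n d e)) ⟩
    monomial (d + e) m             ∎
    where open ≡-Reasoning
  ... | no d≰m = begin
    occ d (upTo (suc m)) * term d  ≡⟨ cong (_* term d) (occ-absent (λ d∈ → d≰m (≤-pred (∈-upTo⁻ d∈)))) ⟩
    0                              ≡⟨ sym (monomial-off (λ m≡d+e → d≰m (subst (d ≤_) (sym m≡d+e) (m≤m+n d e)))) ⟩
    monomial (d + e) m             ∎
    where open ≡-Reasoning

product-of-monomials : ∀ {A : Set} n (g : A → ℕ) xs m →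
  foldr (λ i acc → monomial (n ^ g i) *P acc) oneP xs m ≡ monomial (expo n (map g xs)) m
product-of-monomials n g []       m = refl
product-of-monomials n g (x ∷ xs) m = monomial-mul (n ^ g x) _ _ (product-of-monomials n g xs) m

-- ∏_i X[i,f(i)] = x^{e(labelSeq f)}, since |i - f(i)| = |f(i) - i| and e ignores order
prodTerm-monomial : ∀ n (f : Fun n) m → prodTerm n f m ≡ monomial (expo n (labelSeq f)) m
prodTerm-monomial n f m =
  trans (product-of-monomials n (λ i → ∣ toℕ i - toℕ (f i) ∣) (allFin n) m)
        (cong (λ d → monomial d m) (trans (cong (expo n) labels-symmetric) (expo-↭ n sorting)))
  where
  sorting : map (label f) (allFin n) ↭ labelSeq f
  sorting = ↭-sym (sort-↭ (map (label f) (allFin n)))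
  labels-symmetric : map (λ i → ∣ toℕ i - toℕ (f i) ∣) (allFin n) ≡ map (label f) (allFin n)
  labels-symmetric = LP.map-cong (λ i → ∣-∣-comm (toℕ i) (toℕ (f i))) (allFin n)

coeff-indicator-sum : ∀ {A : Set} {Q : Pred A 0ℓ} (Q? : Decidable Q) (h : A → Poly) m →
  (∀ a → Q a → h a m ≡ 1) → (∀ a → ¬ Q a → h a m ≡ 0) →
  ∀ as → foldr (λ a acc → h a +P acc) zeroP as m ≡ length (filter Q? as)
coeff-indicator-sum Q? h m one zero′ []       = refl
coeff-indicator-sum Q? h m one zero′ (a ∷ as) with Q? a
... | yes qa = cong₂ _+_ (one a qa) (coeff-indicator-sum Q? h m one zero′ as)
... | no ¬qa = cong₂ _+_ (zero′ a ¬qa) (coeff-indicator-sum Q? h m one zero′ as)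

tree-coefficients : (n : ℕ) → 1 ≤ n → (s : List ℕ) →
  Σ (Fun n) (λ f → IsFunctionalTree f × labelSeq f ≡ s) →
  coeff (PX n) (expo n s) ≡ countTrees n s
tree-coefficients n 1≤n s (f₀ , tree-f₀ , refl) =
  coeff-indicator-sum (λ f → isFunctionalTree? f ×-dec LP.≡-dec _≟_ (labelSeq f) s)
    term (expo n s) matching other (allFuns n)
  where
  term : Fun n → Poly
  term f = if does (isFunctionalTree? f) then prodTerm n f else zeroP
  tree-term : ∀ {f} → IsFunctionalTree f → term f (expo n s) ≡ monomial (expo n (labelSeq f)) (expo n s)
  tree-term {f} tree-f = trans
    (cong (λ b → (if b then prodTerm n f else zeroP) (expo n s)) (dec-true (isFunctionalTree? f) tree-f))
    (prodTerm-monomial n f (expo n s))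
  nontree-term : ∀ {f} → ¬ IsFunctionalTree f → term f (expo n s) ≡ 0
  nontree-term {f} ¬tree =
    cong (λ b → (if b then prodTerm n f else zeroP) (expo n s)) (dec-false (isFunctionalTree? f) ¬tree)
  exponents-differ : ∀ {f} → IsFunctionalTree f → labelSeq f ≢ s → expo n (labelSeq f) ≢ expo n s
  exponents-differ {f} tree-f labels≢s eq =
    labels≢s (tree-exponents-injective n 1≤n (labelSeq f) s (f , tree-f , refl) (f₀ , tree-f₀ , refl) eq)
  matching : ∀ f → IsFunctionalTree f × labelSeq f ≡ s → term f (expo n s) ≡ 1
  matching f (tree-f , labels≡s) = trans (tree-term tree-f) (monomial-at (cong (expo n) (sym labels≡s)))
  other : ∀ f → ¬ (IsFunctionalTree f × labelSeq f ≡ s) → term f (expo n s) ≡ 0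
  other f ¬match with isFunctionalTree? f
  ... | no ¬tree   = nontree-term ¬tree
  ... | yes tree-f = trans (tree-term tree-f)
                       (monomial-off (λ eq → exponents-differ tree-f (λ labels≡s → ¬match (tree-f , labels≡s)) (sym eq)))

proposition3p4 : (n : ℕ) → 1 ≤ n →
    ((s t : List ℕ) →
       Σ (Fun n) (λ f → IsFunctionalTree f × labelSeq f ≡ s) →
       Σ (Fun n) (λ g → IsFunctionalTree g × labelSeq g ≡ t) →
       expo n s ≡ expo n t → s ≡ t)
    × ((s : List ℕ) →
       Σ (Fun n) (λ f → IsFunctionalTree f × labelSeq f ≡ s) →
       coeff (PX n) (expo n s) ≡ countTrees n s)
proposition3p4 n 1≤n = tree-exponents-injective n 1≤n , tree-coefficients n 1≤n
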